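{- Let $k \ge r \ge 3$. Let $G$ be a $K_r$-free $k$-partite graph containing an independent set $X$ of size $k$ consisting of exactly one vertex from each part of $G$, such that every non-edge inside $X$ is $K_r$-saturated (adding it creates a $K_r$). Then for each $x \in X$, the graph $G[N(x)]$, viewed as a $(k-1)$-partite graph whose parts are the intersections of $N(x)$ with the $k-1$ parts of $G$ not containing $x$, is $K_{r-1}$-free and the subgraph induced by any $k-2$ of its parts contains a $K_{r-2}$. In particular, $d(x) \ge \beta_1(k-1,r-1)$ for all $x \in X$.
   Context: All graphs are finite and simple; $N(x)$ is the neighbourhood and $d(x)$ the degree of $x$. A $k$-partite graph comes with a fixed partition of its vertex set into $k$ parts (parts may be empty). For $k \ge r \ge 2$ and $1 \le i \le k-r+1$, $\beta_i(k,r)$ is the minimum number of vertices of a $K_r$-free $k$-partite graph such that, for every choice of $k-i$ of its parts, the subgraph induced by those parts contains a $K_{r-1}$. -}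

module Defs where

open import Data.Nat using (ℕ; zero; suc; _∸_; _≤_)
open import Data.Bool using (Bool; true; false)
open import Data.Fin using (Fin; punchIn)
open import Data.Fin.Subset using (Subset; _∈_; ∣_∣)
open import Data.Vec using (tabulate)
open import Data.Product using (Σ; _×_)
open import Data.Sum using (_⊎_)
open import Data.Unit using (⊤)
open import Relation.Nullary using (¬_)
open import Relation.Binary.PropositionalEquality using (_≡_; _≢_)

record Graph (n : ℕ) : Set where
  field
    adj     : Fin n → Fin n → Bool
    adj-sym : ∀ u v → adj u v ≡ adj v u
    adj-irr : ∀ v → adj v v ≡ false

Adj : {n : ℕ} → Graph n → Fin n → Fin n → Set
Adj G u v = Graph.adj G u v ≡ true

nbhd : {n : ℕ} → Graph n → Fin n → Subset n
nbhd G v = tabulate (Graph.adj G v)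

degree : {n : ℕ} → Graph n → Fin n → ℕ
degree G v = ∣ nbhd G v ∣

AdjPlus : {n : ℕ} → Graph n → Fin n → Fin n → Fin n → Fin n → Set
AdjPlus G u v a b = Adj G a b ⊎ ((a ≡ u × b ≡ v) ⊎ (a ≡ v × b ≡ u))

HasClique : {n : ℕ} → (Fin n → Fin n → Set) → ℕ → (Fin n → Set) → Set
HasClique {n} R r S =
  Σ (Fin r → Fin n) λ f → (∀ a → S (f a)) × (∀ a b → a ≢ b → R (f a) (f b))

IsKPartite : {n k : ℕ} → Graph n → (Fin n → Fin k) → Set
IsKPartite G part = ∀ u v → Adj G u v → part u ≢ part v

BetaProperty : (k r i : ℕ) → {n : ℕ} → Graph n → (Fin n → Fin k) → Set
BetaProperty k r i G part =
  IsKPartite G part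
  × ¬ HasClique (Adj G) r (λ _ → ⊤)
  × (∀ (T : Subset k) → ∣ T ∣ ≡ k ∸ i →
       HasClique (Adj G) (r ∸ 1) (λ v → part v ∈ T))

IsBeta : (k r i b : ℕ) → Set
IsBeta k r i b =
  (Σ (Graph b) λ G → Σ (Fin b → Fin k) λ part → BetaProperty k r i G part)
  × (∀ (m : ℕ) (G : Graph m) (part : Fin m → Fin k) →
       BetaProperty k r i G part → b ≤ m)

-- skip i : Fin (k-1) → Fin k enumerates the parts other than i.
skip : {k : ℕ} → Fin k → Fin (k ∸ 1) → Fin k
skip {suc k} i j = punchIn i j

module Submission where

-- Fix x = x i, lying in part i.  Three facts about G give the
-- theorem.
--   * Cone: a K_m inside N(x) together with x is a K_(m+1); as G is K_r-free,
--     N(x) spans no K_(r-1).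
--   * Saturation: if G is K_(m+2)-free but G + uw contains a K_(m+2), that
--     clique uses both u and w, so its remaining m vertices form a K_m in
--     N(u) ∩ N(w).
--   * Counting: a set T of k-2 parts among the k-1 parts other than i omits
--     exactly one part j0.  Saturating the non-edge from x to the vertex of X
--     in part j0 yields a K_(r-2) in N(x) ∩ N(x'); its vertices avoid the
--     parts of x and x' (G is k-partite), hence all lie in parts of T.
-- Finally N(x) is turned into a genuine (k-1)-partite graph on ∣ N(x) ∣
-- vertices (the link of x): the first two facts say exactly that it has the
-- property defining β₁(k-1, r-1), so minimality of β gives β ≤ d(x).

open import Defs
open import Data.Nat using (ℕ; _∸_; _≤_; _<_; suc; z≤n; s≤s; s≤s⁻¹)
open import Data.Nat.Properties using (<-irrefl; ≤-trans)
open import Data.Fin using (Fin; punchIn; punchOut) renaming (zero to fzero; suc to fsuc)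
open import Data.Fin.Properties using (any?; punchIn-injective; punchInᵢ≢i; punchOut-injective; punchIn-punchOut; punchOut-cong; punchOut-punchIn; _≟_)
open import Data.Fin.Subset using (Subset; _∈_; _∉_; ∣_∣; _-_; _⊂_; inside; outside) renaming (⊤ to full)
open import Data.Fin.Subset.Properties using (_∈?_; ∈⊤; ∣⊤∣≡n; p⊆q⇒∣p∣≤∣q∣; p⊂q⇒∣p∣<∣q∣; x∈p⇒∣p-x∣<∣p∣; x∈p∧x≢y⇒x∈p-y)
open import Data.Vec using (_∷_; []; here; there)
open import Data.Vec.Properties using ([]=⇒lookup; lookup⇒[]=; lookup∘tabulate)
open import Data.Product using (Σ; _×_; _,_; proj₁; proj₂)
open import Data.Sum using (inj₁; inj₂)
open import Data.Unit using (⊤; tt)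
open import Relation.Nullary using (¬_; yes; no; ¬?; contradiction)
open import Relation.Binary.PropositionalEquality using (_≡_; _≢_; refl; sym; trans; cong; subst; subst₂)

missing-one : ∀ {n} (T : Subset (suc n)) → ∣ T ∣ ≡ n →
  Σ (Fin (suc n)) λ j₀ → j₀ ∉ T × (∀ j → j ≢ j₀ → j ∈ T)
missing-one {n} T ∣T∣≡n with any? (λ j → ¬? (j ∈? T))
... | no all∈T = contradiction ⊤≤T (<-irrefl (sym ∣T∣≡n))
  where
  -- otherwise full ⊆ T, so 1+n ≤ ∣ T ∣
  ⊤≤T : suc n ≤ ∣ T ∣
  ⊤≤T = subst (_≤ ∣ T ∣) (∣⊤∣≡n (suc n)) (p⊆q⇒∣p∣≤∣q∣ {p = full} λ {j} _ → decide j)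
    where
    decide : ∀ j → j ∈ T
    decide j with j ∈? T
    ... | yes j∈T = j∈T
    ... | no  j∉T = contradiction (j , j∉T) all∈T
... | yes (j₀ , j₀∉T) = j₀ , j₀∉T , others
  where
  -- T ⊆ full - j₀; a second missing element j would make this strict, so
  -- ∣ T ∣ < ∣ full - j₀ ∣ < 1+n, contradicting ∣ T ∣ = n.
  others : ∀ j → j ≢ j₀ → j ∈ T
  others j j≢j₀ with j ∈? T
  ... | yes j∈T = j∈T
  ... | no  j∉T = contradiction ∣T∣<n (<-irrefl ∣T∣≡n)
    where
    T⊂full-j₀ : T ⊂ full - j₀
    T⊂full-j₀ = (λ {t} t∈T → x∈p∧x≢y⇒x∈p-y ∈⊤ λ t≡j₀ → j₀∉T (subst (_∈ T) t≡j₀ t∈T))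
              , j , x∈p∧x≢y⇒x∈p-y ∈⊤ j≢j₀ , j∉T
    ∣T∣<n : ∣ T ∣ < n
    ∣T∣<n = s≤s⁻¹ (≤-trans (s≤s (p⊂q⇒∣p∣<∣q∣ T⊂full-j₀))
              (subst (∣ full - j₀ ∣ <_) (∣⊤∣≡n (suc n)) (x∈p⇒∣p-x∣<∣p∣ {p = full} (∈⊤ {x = j₀}))))

-- A bijection between Fin ∣ S ∣ and the elements of S; it lets us view the
-- subgraph induced on S as a graph with vertex set Fin ∣ S ∣.
record Enumeration {n : ℕ} (S : Subset n) : Set where
  field
    elem       : Fin ∣ S ∣ → Fin n
    elem∈      : ∀ c → elem c ∈ S
    index      : ∀ v → v ∈ S → Fin ∣ S ∣
    elem-index : ∀ v (v∈S : v ∈ S) → elem (index v v∈S) ≡ v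

enumerate : ∀ {n} (S : Subset n) → Enumeration S
enumerate [] = record { elem = λ () ; elem∈ = λ () ; index = λ _ () ; elem-index = λ _ () }
enumerate (inside ∷ S) = record
  { elem = elem ; elem∈ = elem∈ ; index = index ; elem-index = elem-index }
  where
  open Enumeration (enumerate S) renaming
    (elem to elemS; elem∈ to elem∈S; index to indexS; elem-index to elem-indexS)
  elem : Fin (suc ∣ S ∣) → Fin _
  elem fzero    = fzero
  elem (fsuc c) = fsuc (elemS c)
  elem∈ : ∀ c → elem c ∈ inside ∷ S
  elem∈ fzero    = here
  elem∈ (fsuc c) = there (elem∈S c)
  index : ∀ v → v ∈ inside ∷ S → Fin (suc ∣ S ∣)
  index fzero    _           = fzero
  index (fsuc v) (there v∈S) = fsuc (indexS v v∈S)
  elem-index : ∀ v (v∈S : v ∈ inside ∷ S) → elem (index v v∈S) ≡ v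
  elem-index fzero    here        = refl
  elem-index (fsuc v) (there v∈S) = cong fsuc (elem-indexS v v∈S)
enumerate (outside ∷ S) = record
  { elem = λ c → fsuc (elemS c) ; elem∈ = λ c → there (elem∈S c)
  ; index = index ; elem-index = elem-index }
  where
  open Enumeration (enumerate S) renaming
    (elem to elemS; elem∈ to elem∈S; index to indexS; elem-index to elem-indexS)
  index : ∀ v → v ∈ outside ∷ S → Fin ∣ S ∣
  index (fsuc v) (there v∈S) = indexS v v∈S
  elem-index : ∀ v (v∈S : v ∈ outside ∷ S) → fsuc (elemS (index v v∈S)) ≡ v
  elem-index (fsuc v) (there v∈S) = cong fsuc (elem-indexS v v∈S)

clique-mono : ∀ {n m} {R : Fin n → Fin n → Set} {S S′ : Fin n → Set} →
  (∀ v → S v → S′ v) → HasClique R m S → HasClique R m S′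
clique-mono S⊆S′ (f , f∈S , f-clique) = f , (λ a → S⊆S′ (f a) (f∈S a)) , f-clique

avoid₂ : ∀ {m} (a b : Fin (suc (suc m))) → a ≢ b → Fin m → Fin (suc (suc m))
avoid₂ a b a≢b c = punchIn a (punchIn (punchOut a≢b) c)

avoid₂≢first : ∀ {m} (a b : Fin (suc (suc m))) (a≢b : a ≢ b) c → avoid₂ a b a≢b c ≢ a
avoid₂≢first a b a≢b c = punchInᵢ≢i a _

avoid₂≢second : ∀ {m} (a b : Fin (suc (suc m))) (a≢b : a ≢ b) c → avoid₂ a b a≢b c ≢ b
avoid₂≢second a b a≢b c eq =
  punchInᵢ≢i (punchOut a≢b) c (punchIn-injective a _ _ (trans eq (sym (punchIn-punchOut a≢b))))

avoid₂-injective : ∀ {m} (a b : Fin (suc (suc m))) (a≢b : a ≢ b) c d →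
  avoid₂ a b a≢b c ≡ avoid₂ a b a≢b d → c ≡ d
avoid₂-injective a b a≢b c d eq = punchIn-injective _ c d (punchIn-injective a _ _ eq)

module _ {n : ℕ} (G : Graph n) where

  adj-sym : ∀ {u v} → Adj G u v → Adj G v u
  adj-sym {u} {v} uv = trans (Graph.adj-sym G v u) uv

  adj-irrefl : ∀ {u} → ¬ Adj G u u
  adj-irrefl {u} uu with trans (sym uu) (Graph.adj-irr G u)
  ... | ()

  nbhd⇒adj : ∀ {u v} → v ∈ nbhd G u → Adj G u v
  nbhd⇒adj {u} {v} v∈N = trans (sym (lookup∘tabulate (Graph.adj G u) v)) ([]=⇒lookup v∈N)

  adj⇒nbhd : ∀ {u v} → Adj G u v → v ∈ nbhd G u
  adj⇒nbhd {u} {v} uv = lookup⇒[]= v _ (trans (lookup∘tabulate (Graph.adj G u) v) uv)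

  cone : ∀ {m} u → HasClique (Adj G) m (Adj G u) → HasClique (Adj G) (suc m) (λ _ → ⊤)
  cone {m} u (f , f∈N , f-clique) = g , (λ _ → tt) , g-clique
    where
    g : Fin (suc m) → Fin n
    g fzero    = u
    g (fsuc a) = f a
    g-clique : ∀ a b → a ≢ b → Adj G (g a) (g b)
    g-clique fzero    fzero    a≢b = contradiction refl a≢b
    g-clique fzero    (fsuc b) _   = f∈N b
    g-clique (fsuc a) fzero    _   = adj-sym (f∈N a)
    g-clique (fsuc a) (fsuc b) a≢b = f-clique a b (λ a≡b → a≢b (cong fsuc a≡b))

  module _ {u w : Fin n} where

    plus-avoiding-first : ∀ {s t} → AdjPlus G u w s t → s ≢ u → t ≢ u → Adj G s t
    plus-avoiding-first (inj₁ st)               _   _   = st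
    plus-avoiding-first (inj₂ (inj₁ (s≡u , _))) s≢u _   = contradiction s≡u s≢u
    plus-avoiding-first (inj₂ (inj₂ (_ , t≡u))) _   t≢u = contradiction t≡u t≢u

    plus-avoiding-second : ∀ {s t} → AdjPlus G u w s t → s ≢ w → t ≢ w → Adj G s t
    plus-avoiding-second (inj₁ st)               _   _   = st
    plus-avoiding-second (inj₂ (inj₁ (_ , t≡w))) _   t≢w = contradiction t≡w t≢w
    plus-avoiding-second (inj₂ (inj₂ (s≡w , _))) s≢w _   = contradiction s≡w s≢w

    plus-outside : ∀ {s t} → AdjPlus G u w s t → s ≢ u → s ≢ w → Adj G s t
    plus-outside (inj₁ st)               _   _   = st
    plus-outside (inj₂ (inj₁ (s≡u , _))) s≢u _   = contradiction s≡u s≢u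
    plus-outside (inj₂ (inj₂ (s≡w , _))) _   s≢w = contradiction s≡w s≢w

    plus-irrefl : u ≢ w → ∀ {s} → ¬ AdjPlus G u w s s
    plus-irrefl _   (inj₁ ss)                 = adj-irrefl ss
    plus-irrefl u≢w (inj₂ (inj₁ (s≡u , s≡w))) = u≢w (trans (sym s≡u) s≡w)
    plus-irrefl u≢w (inj₂ (inj₂ (s≡w , s≡u))) = u≢w (trans (sym s≡u) s≡w)

  saturated-common-clique : ∀ m {u w} → u ≢ w →
    ¬ HasClique (Adj G) (suc (suc m)) (λ _ → ⊤) →
    HasClique (AdjPlus G u w) (suc (suc m)) (λ _ → ⊤) →
    HasClique (Adj G) m (λ v → Adj G u v × Adj G w v)
  saturated-common-clique m {u} {w} u≢w free (f , _ , f-clique)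
    with any? (λ a → f a ≟ u) | any? (λ a → f a ≟ w)
  ... | no u∉f | _ = contradiction (f , (λ _ → tt) , λ a b a≢b →
          plus-avoiding-first (f-clique a b a≢b) (λ e → u∉f (a , e)) (λ e → u∉f (b , e))) free
  ... | _ | no w∉f = contradiction (f , (λ _ → tt) , λ a b a≢b →
          plus-avoiding-second (f-clique a b a≢b) (λ e → w∉f (a , e)) (λ e → w∉f (b , e))) free
  ... | yes (a , fa≡u) | yes (b , fb≡w) = h , h-common , h-clique
    where
    a≢b : a ≢ b
    a≢b a≡b = u≢w (trans (sym fa≡u) (trans (cong f a≡b) fb≡w))
    f-injective : ∀ c d → c ≢ d → f c ≢ f d
    f-injective c d c≢d fc≡fd =
      plus-irrefl u≢w (subst (AdjPlus G u w (f c)) (sym fc≡fd) (f-clique c d c≢d))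
    pos : Fin m → Fin (suc (suc m))
    pos = avoid₂ a b a≢b
    h : Fin m → Fin n
    h c = f (pos c)
    h≢u : ∀ c → h c ≢ u
    h≢u c e = f-injective (pos c) a (avoid₂≢first a b a≢b c) (trans e (sym fa≡u))
    h≢w : ∀ c → h c ≢ w
    h≢w c e = f-injective (pos c) b (avoid₂≢second a b a≢b c) (trans e (sym fb≡w))
    edge-to : ∀ c e → pos c ≢ e → Adj G (h c) (f e)
    edge-to c e ne = plus-outside (f-clique (pos c) e ne) (h≢u c) (h≢w c)
    h-common : ∀ c → Adj G u (h c) × Adj G w (h c)
    h-common c = adj-sym (subst (Adj G (h c)) fa≡u (edge-to c a (avoid₂≢first a b a≢b c)))
               , adj-sym (subst (Adj G (h c)) fb≡w (edge-to c b (avoid₂≢second a b a≢b c)))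
    h-clique : ∀ c d → c ≢ d → Adj G (h c) (h d)
    h-clique c d c≢d = edge-to c (pos d) (λ e → c≢d (avoid₂-injective a b a≢b c d e))

  induced : (S : Subset n) → Graph ∣ S ∣
  induced S = record
    { adj     = λ c d → Graph.adj G (elem c) (elem d)
    ; adj-sym = λ c d → Graph.adj-sym G (elem c) (elem d)
    ; adj-irr = λ c → Graph.adj-irr G (elem c) }
    where open Enumeration (enumerate S)

  induced-clique⇒clique : ∀ {m} S {P} → HasClique (Adj (induced S)) m P →
    HasClique (Adj G) m (_∈ S)
  induced-clique⇒clique S (f , _ , f-clique) = (λ a → elem (f a)) , (λ a → elem∈ (f a)) , f-clique
    where open Enumeration (enumerate S)

  clique⇒induced-clique : ∀ {m} S {Q : Fin n → Set} →
    HasClique (Adj G) m (λ v → v ∈ S × Q v) →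
    HasClique (Adj (induced S)) m (λ c → Q (Enumeration.elem (enumerate S) c))
  clique⇒induced-clique S {Q} (f , f∈S , f-clique) = g , g∈Q , g-clique
    where
    open Enumeration (enumerate S)
    g : _ → Fin ∣ S ∣
    g a = index (f a) (proj₁ (f∈S a))
    elem-g : ∀ a → elem (g a) ≡ f a
    elem-g a = elem-index (f a) (proj₁ (f∈S a))
    g∈Q : ∀ a → Q (elem (g a))
    g∈Q a = subst Q (sym (elem-g a)) (proj₂ (f∈S a))
    g-clique : ∀ a b → a ≢ b → Adj (induced S) (g a) (g b)
    g-clique a b a≢b = subst₂ (Adj G) (sym (elem-g a)) (sym (elem-g b)) (f-clique a b a≢b)

module Link {n K : ℕ} (G : Graph n) (part : Fin n → Fin (suc K))
            (partite : IsKPartite G part) (u : Fin n) (i : Fin (suc K)) (u∈i : part u ≡ i) where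

  open Enumeration (enumerate (nbhd G u))

  InParts : Subset K → Fin n → Set
  InParts T v = Σ (Fin K) λ j → j ∈ T × part v ≡ punchIn i j

  linkGraph : Graph (degree G u)
  linkGraph = induced G (nbhd G u)

  neighbour-part : ∀ {v} → Adj G u v → i ≢ part v
  neighbour-part uv i≡v = partite _ _ uv (trans u∈i i≡v)

  elem-avoids-i : ∀ c → i ≢ part (elem c)
  elem-avoids-i c = neighbour-part (nbhd⇒adj G (elem∈ c))

  linkPart : Fin (degree G u) → Fin K
  linkPart c = punchOut (elem-avoids-i c)

  linkPartite : IsKPartite linkGraph linkPart
  linkPartite c d cd same =
    partite _ _ cd (punchOut-injective (elem-avoids-i c) (elem-avoids-i d) same)

  link-free : ∀ {m} → ¬ HasClique (Adj G) m (Adj G u) → ¬ HasClique (Adj linkGraph) m (λ _ → ⊤)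
  link-free N-free link-clique =
    N-free (clique-mono {R = Adj G} (λ v → nbhd⇒adj G {u} {v})
      (induced-clique⇒clique G (nbhd G u) link-clique))

  link-cover : ∀ {m} (T : Subset K) →
    HasClique (Adj G) m (λ v → Adj G u v × InParts T v) →
    HasClique (Adj linkGraph) m (λ c → linkPart c ∈ T)
  link-cover T clique =
    clique-mono {R = Adj linkGraph} in-T
      (clique⇒induced-clique G (nbhd G u) {Q = InParts T} (clique-mono {R = Adj G} in-N clique))
    where
    in-N : ∀ v → Adj G u v × InParts T v → v ∈ nbhd G u × InParts T v
    in-N _ (uv , v∈T) = adj⇒nbhd G uv , v∈T
    in-T : ∀ c → InParts T (elem c) → linkPart c ∈ T
    in-T c (j , j∈T , c∈j) =
      subst (_∈ T) (sym (trans (punchOut-cong i c∈j) (punchOut-punchIn i))) j∈T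

saturated-clique-in-parts : ∀ {n K} m (G : Graph n) (part : Fin n → Fin (suc K)) →
  IsKPartite G part → ¬ HasClique (Adj G) (suc (suc m)) (λ _ → ⊤) →
  ∀ {u w} i j₀ → part u ≡ i → part w ≡ punchIn i j₀ →
  HasClique (AdjPlus G u w) (suc (suc m)) (λ _ → ⊤) →
  (T : Subset K) → (∀ j → j ≢ j₀ → j ∈ T) →
  HasClique (Adj G) m (λ v → Adj G u v × Σ (Fin K) λ j → j ∈ T × part v ≡ punchIn i j)
saturated-clique-in-parts m G part partite free {u} {w} i j₀ u∈i w∈j₀ saturated T others =
  clique-mono {R = Adj G} place (saturated-common-clique G m u≢w free saturated)
  where
  u≢w : u ≢ w
  u≢w u≡w = punchInᵢ≢i i j₀ (trans (sym w∈j₀) (trans (cong part (sym u≡w)) u∈i))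
  place : ∀ v → Adj G u v × Adj G w v →
    Adj G u v × Σ (Fin _) λ j → j ∈ T × part v ≡ punchIn i j
  place v (uv , wv) = uv , punchOut i≢v , others _ j≢j₀ , sym (punchIn-punchOut i≢v)
    where
    i≢v : i ≢ part v
    i≢v i≡v = partite u v uv (trans u∈i i≡v)
    j≢j₀ : punchOut i≢v ≢ j₀
    j≢j₀ j≡j₀ =
      partite w v wv (trans w∈j₀ (trans (cong (punchIn i) (sym j≡j₀)) (punchIn-punchOut i≢v)))

lemma3p2 : (k r : ℕ) → 3 ≤ r → r ≤ k →
    {n : ℕ} (G : Graph n) (part : Fin n → Fin k) → IsKPartite G part →
    ¬ HasClique (Adj G) r (λ _ → ⊤) →
    (x : Fin k → Fin n) → (∀ i → part (x i) ≡ i) →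
    (∀ i j → ¬ Adj G (x i) (x j)) →
    (∀ i j → i ≢ j → HasClique (AdjPlus G (x i) (x j)) r (λ _ → ⊤)) →
    ∀ i →
    (¬ HasClique (Adj G) (r ∸ 1) (λ v → Adj G (x i) v))
    × (∀ (T : Subset (k ∸ 1)) → ∣ T ∣ ≡ (k ∸ 1) ∸ 1 →
    HasClique (Adj G) (r ∸ 2)
    (λ v → Adj G (x i) v × Σ (Fin (k ∸ 1)) λ j → j ∈ T × part v ≡ skip i j))
    × (∀ (b : ℕ) → IsBeta (k ∸ 1) (r ∸ 1) 1 b → b ≤ degree G (x i))
lemma3p2 (suc (suc (suc k₀))) (suc (suc (suc r₀))) (s≤s (s≤s (s≤s z≤n))) (s≤s (s≤s (s≤s _)))
         G part partite free x x∈part _ saturated i =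
  N-free , N-cover , degree-bound
  where
  open Link G part partite (x i) i (x∈part i)
  N-free : ¬ HasClique (Adj G) (suc (suc r₀)) (Adj G (x i))
  N-free clique = free (cone G (x i) clique)
  N-cover : ∀ T → ∣ T ∣ ≡ suc k₀ → HasClique (Adj G) (suc r₀)
    (λ v → Adj G (x i) v × Σ (Fin (suc (suc k₀))) λ j → j ∈ T × part v ≡ punchIn i j)
  N-cover T ∣T∣≡ with missing-one T ∣T∣≡
  ... | j₀ , _ , others =
    saturated-clique-in-parts (suc r₀) G part partite free i j₀ (x∈part i) (x∈part (punchIn i j₀))
      (saturated i (punchIn i j₀) (λ i≡ → punchInᵢ≢i i j₀ (sym i≡))) T others
  degree-bound : ∀ b → IsBeta (suc (suc k₀)) (suc (suc r₀)) 1 b → b ≤ degree G (x i)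
  degree-bound b (_ , minimal) = minimal _ linkGraph linkPart
    (linkPartite , link-free N-free , λ T ∣T∣≡ → link-cover T (N-cover T ∣T∣≡))
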